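{- Both of the recurrences $$C(n)=C(n-C(n-1))+C(n-1-C(n-2))\quad(n\ge 3),\qquad C(1)=1,\ C(2)=2,$$ and $$H(n)=H(n-H(n-2))+H(n-3-H(n-5))\quad(n\ge 6),\qquad H(1)=1,\ H(2)=H(3)=2,\ H(4)=3,\ H(5)=4,$$ have the Conolly sequence as their (well-defined) solution.
   Context: The ruler function $r_m$ ($m\ge1$) is $1$ plus the exponent of $2$ in the prime factorization of $m$. The Conolly sequence is the nondecreasing sequence of positive integers in which each positive integer $m$ occurs exactly $r_m$ times: $1,2,2,3,4,4,4,5,6,6,7,8,8,8,8,9,\dots$. -}

module Defs where

open import Data.Nat using (ℕ; zero; suc; _+_; _∸_; _≤_; _<_)
open import Data.Nat.DivMod using (_/_; _%_)
open import Data.Bool using (if_then_else_)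
open import Data.Nat using (_≡ᵇ_)
open import Data.List using (List; []; _∷_; concatMap; replicate; map; upTo)
open import Data.Product using (_×_)
open import Relation.Binary.PropositionalEquality using (_≡_)

-- Exponent of 2 in m (for m ≥ 1), computed with fuel; fuel m suffices
-- since the exponent of 2 in m ≥ 1 is < m.
v2-fuel : ℕ → ℕ → ℕ
v2-fuel zero    m = 0
v2-fuel (suc f) zero = 0
v2-fuel (suc f) (suc k) =
  if ((suc k) % 2) ≡ᵇ 0 then suc (v2-fuel f ((suc k) / 2)) else 0

v2 : ℕ → ℕ
v2 m = v2-fuel m m

ruler : ℕ → ℕ
ruler m = suc (v2 m)

conollyPrefix : ℕ → List ℕ
conollyPrefix N = concatMap (λ m → replicate (ruler m) m) (map suc (upTo N))

-- 0-based indexing with default 0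
at : List ℕ → ℕ → ℕ
at []       _       = 0
at (x ∷ xs) zero    = x
at (x ∷ xs) (suc i) = at xs i

-- Conolly sequence, 1-indexed: conolly n is the n-th term (n ≥ 1).
-- Each m ≥ 1 occurs at least once, so the first n terms lie in conollyPrefix n.
-- (conolly 0 = 0 is a dummy value, never used.)
conolly : ℕ → ℕ
conolly zero    = 0
conolly (suc i) = at (conollyPrefix (suc i)) i

SolvesC : (ℕ → ℕ) → Set
SolvesC C = C 1 ≡ 1 × C 2 ≡ 2 ×
  (∀ n → 3 ≤ n → C n ≡ C (n ∸ C (n ∸ 1)) + C (n ∸ 1 ∸ C (n ∸ 2)))

-- well-definedness: every argument on the right-hand side lies in [1, n-1]
-- (in particular no truncation of ∸ occurs)
WellDefinedC : (ℕ → ℕ) → Set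
WellDefinedC C = ∀ n → 3 ≤ n →
  (1 ≤ n ∸ C (n ∸ 1) × n ∸ C (n ∸ 1) < n) ×
  (1 ≤ n ∸ 1 ∸ C (n ∸ 2) × n ∸ 1 ∸ C (n ∸ 2) < n)

SolvesH : (ℕ → ℕ) → Set
SolvesH H = H 1 ≡ 1 × H 2 ≡ 2 × H 3 ≡ 2 × H 4 ≡ 3 × H 5 ≡ 4 ×
  (∀ n → 6 ≤ n → H n ≡ H (n ∸ H (n ∸ 2)) + H (n ∸ 3 ∸ H (n ∸ 5)))

WellDefinedH : (ℕ → ℕ) → Set
WellDefinedH H = ∀ n → 6 ≤ n →
  (1 ≤ n ∸ H (n ∸ 2) × n ∸ H (n ∸ 2) < n) ×
  (1 ≤ n ∸ 3 ∸ H (n ∸ 5) × n ∸ 3 ∸ H (n ∸ 5) < n)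

-- "f is the (well-defined) solution" : the reference sequence satisfies the
-- recurrence with all arguments in range, and every solution agrees with it
-- on positive indices.
IsWellDefinedSolutionC : (ℕ → ℕ) → Set
IsWellDefinedSolutionC f =
  SolvesC f × WellDefinedC f × ((g : ℕ → ℕ) → SolvesC g → ∀ n → 1 ≤ n → g n ≡ f n)

IsWellDefinedSolutionH : (ℕ → ℕ) → Set
IsWellDefinedSolutionH f =
  SolvesH f × WellDefinedH f × ((g : ℕ → ℕ) → SolvesH g → ∀ n → 1 ≤ n → g n ≡ f n)

module Submission where

-- Write Q v = r_1 + ... + r_v, so that the block of the value
-- v+1 in the Conolly sequence C occupies the positions Q v + 1 .. Q v + r_{v+1}.
-- Since r_{2k+1} = 1 and r_{2k+2} = 1 + r_{k+1}, we get Q (2k) = 2k + Q k: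
-- for a position n = Q (2k) + j in the blocks of 2k+1 and 2k+2, subtracting
-- 2k ≈ C(n) gives Q k + j, a position at level k.  Classifying every position as the single position of an odd value
-- 2k+1 or a position of an even value 2k+2 (the view 'Position'), this yields
-- closed forms for the nested terms of both recurrences:
--   C(n - C(n-1)) = ⌈C(n)/2⌉,   C(n-1 - C(n-2)) = ⌈C(n-1)/2⌉,
--   C(n - C(n-2)) = h (C(n)),   C(n-3 - C(n-5)) = h (C(n-3)),
-- where h (4t + s) = 2t + (0,1,2,2)_s.  The recurrences then reduce to the
-- identities C(n) = ⌈C(n)/2⌉ + ⌈C(n-1)/2⌉ and C(n) = h (C(n)) + h (C(n-3)),
-- again proved by the position view.  Finally, for a general nested recurrence
-- we show that bounded solutions (1 ≤ f m ≤ m) only use arguments in range and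
-- that such a solution is determined by its initial values; the theorem
-- instantiates this for C and H.

open import Defs
open import Data.Nat using (ℕ; zero; suc; _+_; _*_; _∸_; _≤_; _<_; z≤n; s≤s; z<s; s<s; _≡ᵇ_; ⌈_/2⌉)
open import Data.Nat.Properties
open import Data.Nat.DivMod using (_/_; _%_; m/n<m; [m+kn]%n≡m%n; m*n%n≡0; m*n/n≡m)
open import Data.Bool using (true; false)
open import Data.List using (List; []; _∷_; _++_; concatMap; replicate; map; upTo; length; [_])
open import Data.List.Properties using (upTo-∷ʳ; map-++; ++-assoc; length-++; length-replicate; ++-identityʳ)
open import Data.Product using (_×_; _,_; proj₁; proj₂)
open import Data.Sum using (inj₁; inj₂)
open import Data.Nat.Induction using (<-rec)
open import Relation.Nullary using (yes; no)
open import Relation.Binary.PropositionalEquality hiding ([_])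
open ≡-Reasoning
open import Algebra.Properties.CommutativeSemigroup +-commutativeSemigroup using (x∙yz≈y∙xz)

v2-fuel-stable : ∀ f g m → m ≤ f → m ≤ g → v2-fuel f m ≡ v2-fuel g m
v2-fuel-stable zero    zero    zero    _       _       = refl
v2-fuel-stable zero    (suc g) zero    _       _       = refl
v2-fuel-stable (suc f) zero    zero    _       _       = refl
v2-fuel-stable (suc f) (suc g) zero    _       _       = refl
v2-fuel-stable (suc f) (suc g) (suc k) (s≤s m≤f) (s≤s m≤g) with (suc k % 2) ≡ᵇ 0
... | true  = cong suc (v2-fuel-stable f g (suc k / 2) (≤-trans half≤k m≤f) (≤-trans half≤k m≤g))
  where half≤k : suc k / 2 ≤ k
        half≤k = ≤-pred (m/n<m (suc k) 2 (s≤s (s≤s z≤n)))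
... | false = refl

ruler-odd : ∀ k → ruler (suc (k * 2)) ≡ 1
ruler-odd k rewrite [m+kn]%n≡m%n 1 k 2 ⦃ _ ⦄ = refl

ruler-double : ∀ k → ruler (suc k * 2) ≡ suc (ruler (suc k))
ruler-double k rewrite m*n%n≡0 (suc k) 2 ⦃ _ ⦄ | m*n/n≡m (suc k) 2 ⦃ _ ⦄ =
  cong (λ v → suc (suc v)) (v2-fuel-stable (suc (k * 2)) (suc k) (suc k) (s≤s (m≤m*n k 2)) ≤-refl)

-- Q v = r_1 + ... + r_v is the position of the last occurrence of v in the
-- Conolly sequence; the block of v occupies the positions Q (v-1) + 1 .. Q v.
Q : ℕ → ℕ
Q zero    = 0
Q (suc v) = ruler (suc v) + Q v

Q-mono : ∀ {m n} → m ≤ n → Q m ≤ Q n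
Q-mono {n = zero}  z≤n = ≤-refl
Q-mono {n = suc n} m≤1+n with m≤n⇒m<n∨m≡n m≤1+n
... | inj₂ refl       = ≤-refl
... | inj₁ (s≤s m≤n) = ≤-trans (Q-mono m≤n) (m≤n+m (Q n) (ruler (suc n)))

-- Every value occurs at least once, so the block of v ends at or after v.
v≤Q : ∀ v → v ≤ Q v
v≤Q zero    = z≤n
v≤Q (suc v) = s≤s (≤-trans (v≤Q v) (m≤n+m (Q v) (v2 (suc v))))

concatMap-++ : ∀ (f : ℕ → List ℕ) xs ys → concatMap f (xs ++ ys) ≡ concatMap f xs ++ concatMap f ys
concatMap-++ f []       ys = refl
concatMap-++ f (x ∷ xs) ys =
  trans (cong (f x ++_) (concatMap-++ f xs ys)) (sym (++-assoc (f x) (concatMap f xs) (concatMap f ys)))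

conollyPrefix-suc : ∀ N → conollyPrefix (suc N) ≡ conollyPrefix N ++ replicate (ruler (suc N)) (suc N)
conollyPrefix-suc N = begin
    concatMap block (map suc (upTo (suc N)))
  ≡⟨ cong (λ l → concatMap block (map suc l)) (sym (upTo-∷ʳ N)) ⟩
    concatMap block (map suc (upTo N ++ [ N ]))
  ≡⟨ cong (concatMap block) (map-++ suc (upTo N) [ N ]) ⟩
    concatMap block (map suc (upTo N) ++ [ suc N ])
  ≡⟨ concatMap-++ block (map suc (upTo N)) [ suc N ] ⟩
    conollyPrefix N ++ (replicate (ruler (suc N)) (suc N) ++ [])
  ≡⟨ cong (conollyPrefix N ++_) (++-identityʳ _) ⟩
    conollyPrefix N ++ replicate (ruler (suc N)) (suc N) ∎
  where block : ℕ → List ℕ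
        block m = replicate (ruler m) m

length-conollyPrefix : ∀ N → length (conollyPrefix N) ≡ Q N
length-conollyPrefix zero    = refl
length-conollyPrefix (suc N) = begin
    length (conollyPrefix (suc N))
  ≡⟨ cong length (conollyPrefix-suc N) ⟩
    length (conollyPrefix N ++ replicate (ruler (suc N)) (suc N))
  ≡⟨ length-++ (conollyPrefix N) ⟩
    length (conollyPrefix N) + length (replicate (ruler (suc N)) (suc N))
  ≡⟨ cong₂ _+_ (length-conollyPrefix N) (length-replicate (ruler (suc N))) ⟩
    Q N + ruler (suc N)
  ≡⟨ +-comm (Q N) (ruler (suc N)) ⟩
    Q (suc N) ∎

at-++ˡ : ∀ xs ys i → i < length xs → at (xs ++ ys) i ≡ at xs i
at-++ˡ (x ∷ xs) ys zero    _       = refl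
at-++ˡ (x ∷ xs) ys (suc i) (s≤s i<n) = at-++ˡ xs ys i i<n

at-++ʳ : ∀ xs ys j → at (xs ++ ys) (length xs + j) ≡ at ys j
at-++ʳ []       ys j = refl
at-++ʳ (x ∷ xs) ys j = at-++ʳ xs ys j

at-replicate : ∀ r v j → j < r → at (replicate r v) j ≡ v
at-replicate (suc r) v zero    _       = refl
at-replicate (suc r) v (suc j) (s≤s j<r) = at-replicate r v j j<r

at-conollyPrefix : ∀ N v j → v < N → j < ruler (suc v) → at (conollyPrefix N) (j + Q v) ≡ suc v
at-conollyPrefix (suc N) v j v<1+N j<r rewrite conollyPrefix-suc N with m≤n⇒m<n∨m≡n (≤-pred v<1+N)
... | inj₁ v<N = trans (at-++ˡ (conollyPrefix N) _ (j + Q v) inside) (at-conollyPrefix N v j v<N j<r)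
  where inside : j + Q v < length (conollyPrefix N)
        inside = subst (j + Q v <_) (sym (length-conollyPrefix N))
                       (≤-trans (+-monoˡ-< (Q v) j<r) (Q-mono v<N))
... | inj₂ refl = begin
    at (conollyPrefix v ++ replicate (ruler (suc v)) (suc v)) (j + Q v)
  ≡⟨ cong (at (conollyPrefix v ++ _)) (trans (+-comm j (Q v)) (cong (_+ j) (sym (length-conollyPrefix v)))) ⟩
    at (conollyPrefix v ++ replicate (ruler (suc v)) (suc v)) (length (conollyPrefix v) + j)
  ≡⟨ at-++ʳ (conollyPrefix v) _ j ⟩
    at (replicate (ruler (suc v)) (suc v)) j
  ≡⟨ at-replicate (ruler (suc v)) (suc v) j j<r ⟩
    suc v ∎

conolly-block : ∀ v j → j < ruler (suc v) → conolly (suc (j + Q v)) ≡ suc v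
conolly-block v j j<r = at-conollyPrefix (suc (j + Q v)) v j (s≤s (≤-trans (v≤Q v) (m≤n+m (Q v) j))) j<r

conolly-Q : ∀ v → conolly (Q v) ≡ v
conolly-Q zero    = refl
conolly-Q (suc v) = conolly-block v (v2 (suc v)) ≤-refl

Q-after-odd : ∀ k → Q (suc (k * 2)) ≡ suc (Q (k * 2))
Q-after-odd k = cong (_+ Q (k * 2)) (ruler-odd k)

Q-even-end : ∀ k → Q (suc k * 2) ≡ suc (suc (ruler (suc k) + Q (k * 2)))
Q-even-end k = begin
    ruler (suc k * 2) + Q (suc (k * 2))
  ≡⟨ cong₂ _+_ (ruler-double k) (Q-after-odd k) ⟩
    suc (ruler (suc k) + suc (Q (k * 2)))
  ≡⟨ cong suc (+-suc (ruler (suc k)) (Q (k * 2))) ⟩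
    suc (suc (ruler (suc k) + Q (k * 2))) ∎

Q-double : ∀ k → Q (k * 2) ≡ k * 2 + Q k
Q-double zero    = refl
Q-double (suc k) = begin
    Q (suc k * 2)
  ≡⟨ Q-even-end k ⟩
    suc (suc (ruler (suc k) + Q (k * 2)))
  ≡⟨ cong (λ q → suc (suc (ruler (suc k) + q))) (Q-double k) ⟩
    suc (suc (ruler (suc k) + (k * 2 + Q k)))
  ≡⟨ cong (λ m → suc (suc m)) (x∙yz≈y∙xz (ruler (suc k)) (k * 2) (Q k)) ⟩
    suc k * 2 + Q (suc k) ∎

Q-halving : ∀ k j → j + Q (k * 2) ∸ k * 2 ≡ j + Q k
Q-halving k j = begin
    j + Q (k * 2) ∸ k * 2
  ≡⟨ cong (λ q → j + q ∸ k * 2) (Q-double k) ⟩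
    j + (k * 2 + Q k) ∸ k * 2
  ≡⟨ cong (_∸ k * 2) (x∙yz≈y∙xz j (k * 2) (Q k)) ⟩
    k * 2 + (j + Q k) ∸ k * 2
  ≡⟨ m+n∸m≡n (k * 2) (j + Q k) ⟩
    j + Q k ∎

-- Positions n ≥ 1 of the Conolly sequence, classified by the block containing
-- them: the single position of the odd value 2k+1, or the i-th position
-- (0 ≤ i ≤ r_{k+1}) of the even value 2k+2.
data Position : ℕ → Set where
  odd-block  : ∀ k → Position (suc (Q (k * 2)))
  even-block : ∀ k i → i ≤ ruler (suc k) → Position (suc (suc (i + Q (k * 2))))

position : ∀ x → Position (suc x)
position zero = odd-block 0
position (suc x) with position x
... | odd-block k = even-block k 0 z≤n
... | even-block k i i≤r with m≤n⇒m<n∨m≡n i≤r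
...   | inj₁ i<r  = even-block k (suc i) i<r
...   | inj₂ refl = subst Position (cong suc (Q-even-end k)) (odd-block (suc k))

conolly-odd : ∀ k → conolly (suc (Q (k * 2))) ≡ suc (k * 2)
conolly-odd k = conolly-block (k * 2) 0 (s≤s z≤n)

conolly-even : ∀ k i → i ≤ ruler (suc k) → conolly (suc (suc (i + Q (k * 2)))) ≡ suc k * 2
conolly-even k i i≤r = begin
    conolly (suc (suc (i + Q (k * 2))))
  ≡⟨ cong (λ q → conolly (suc q)) (sym (trans (cong (i +_) (Q-after-odd k)) (+-suc i (Q (k * 2))))) ⟩
    conolly (suc (i + Q (suc (k * 2))))
  ≡⟨ conolly-block (suc (k * 2)) i (subst (i <_) (sym (ruler-double k)) (s≤s i≤r)) ⟩
    suc k * 2 ∎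

conolly-next-odd : ∀ k → conolly (suc (suc (suc (ruler (suc k) + Q (k * 2))))) ≡ suc (suc k * 2)
conolly-next-odd k = subst (λ q → conolly (suc q) ≡ suc (suc k * 2)) (Q-even-end k) (conolly-odd (suc k))

conolly-next-even : ∀ k → conolly (suc (suc (suc (suc (ruler (suc k) + Q (k * 2)))))) ≡ suc (suc k) * 2
conolly-next-even k =
  subst (λ q → conolly (suc (suc q)) ≡ suc (suc k) * 2) (Q-even-end k) (conolly-even (suc k) 0 z≤n)

conolly-bounds : ∀ m → 1 ≤ m → 1 ≤ conolly m × conolly m ≤ m
conolly-bounds (suc x) _ with position x
... | odd-block k rewrite conolly-odd k = s≤s z≤n , s≤s (v≤Q (k * 2))
... | even-block k i i≤r rewrite conolly-even k i i≤r =
  s≤s z≤n , s≤s (s≤s (≤-trans (v≤Q (k * 2)) (m≤n+m (Q (k * 2)) i)))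

⌈k*2/2⌉ : ∀ k → ⌈ k * 2 /2⌉ ≡ k
⌈k*2/2⌉ zero    = refl
⌈k*2/2⌉ (suc k) = cong suc (⌈k*2/2⌉ k)

⌈1+k*2/2⌉ : ∀ k → ⌈ suc (k * 2) /2⌉ ≡ suc k
⌈1+k*2/2⌉ zero    = refl
⌈1+k*2/2⌉ (suc k) = cong suc (⌈1+k*2/2⌉ k)

k*2≡k+k : ∀ k → k * 2 ≡ k + k
k*2≡k+k k = trans (*-comm k 2) (cong (k +_) (+-identityʳ k))

conolly-nested-⌈/2⌉ : ∀ x → conolly (suc x ∸ conolly x) ≡ ⌈ conolly (suc x) /2⌉
conolly-nested-⌈/2⌉ zero = refl
conolly-nested-⌈/2⌉ (suc x) with position x
... | odd-block k = begin
    conolly (suc (suc (Q (k * 2))) ∸ conolly (suc (Q (k * 2))))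
  ≡⟨ cong (λ c → conolly (suc (suc (Q (k * 2))) ∸ c)) (conolly-odd k) ⟩
    conolly (1 + Q (k * 2) ∸ k * 2)
  ≡⟨ cong conolly (Q-halving k 1) ⟩
    conolly (suc (Q k))
  ≡⟨ conolly-block k 0 (s≤s z≤n) ⟩
    suc k
  ≡⟨ sym (⌈k*2/2⌉ (suc k)) ⟩
    ⌈ suc k * 2 /2⌉
  ≡⟨ cong ⌈_/2⌉ (sym (conolly-even k 0 z≤n)) ⟩
    ⌈ conolly (suc (suc (Q (k * 2)))) /2⌉ ∎
... | even-block k i i≤r = begin
    conolly (suc (suc (suc (i + Q (k * 2)))) ∸ conolly (suc (suc (i + Q (k * 2)))))
  ≡⟨ cong (λ c → conolly (suc (suc (suc (i + Q (k * 2)))) ∸ c)) (conolly-even k i i≤r) ⟩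
    conolly (suc i + Q (k * 2) ∸ k * 2)
  ≡⟨ cong conolly (Q-halving k (suc i)) ⟩
    conolly (suc (i + Q k))
  ≡⟨ next-block i≤r ⟩
    ⌈ conolly (suc (suc (suc (i + Q (k * 2))))) /2⌉ ∎
  where
    next-block : ∀ {i} → i ≤ ruler (suc k) →
                 conolly (suc (i + Q k)) ≡ ⌈ conolly (suc (suc (suc (i + Q (k * 2))))) /2⌉
    next-block {i} i≤r with m≤n⇒m<n∨m≡n i≤r
    ... | inj₁ i<r = trans (conolly-block k i i<r)
                           (sym (trans (cong ⌈_/2⌉ (conolly-even k (suc i) i<r)) (⌈k*2/2⌉ (suc k))))
    ... | inj₂ refl = trans (conolly-block (suc k) 0 (s≤s z≤n))
                            (sym (trans (cong ⌈_/2⌉ (conolly-next-odd k)) (⌈1+k*2/2⌉ (suc k))))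

conolly-halves : ∀ x → conolly (suc x) ≡ ⌈ conolly (suc x) /2⌉ + ⌈ conolly x /2⌉
conolly-halves x with position x
... | odd-block k =
  trans (conolly-odd k) (trans (cong suc (k*2≡k+k k)) (sym (cong₂ _+_
    (trans (cong ⌈_/2⌉ (conolly-odd k)) (⌈1+k*2/2⌉ k))
    (trans (cong ⌈_/2⌉ (conolly-Q (k * 2))) (⌈k*2/2⌉ k)))))
... | even-block k zero i≤r =
  trans (conolly-even k 0 i≤r) (trans (k*2≡k+k (suc k)) (sym (cong₂ _+_
    (trans (cong ⌈_/2⌉ (conolly-even k 0 i≤r)) (⌈k*2/2⌉ (suc k)))
    (trans (cong ⌈_/2⌉ (conolly-odd k)) (⌈1+k*2/2⌉ k)))))
... | even-block k (suc i) i≤r =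
  trans (conolly-even k (suc i) i≤r) (trans (k*2≡k+k (suc k)) (sym (cong₂ _+_
    (trans (cong ⌈_/2⌉ (conolly-even k (suc i) i≤r)) (⌈k*2/2⌉ (suc k)))
    (trans (cong ⌈_/2⌉ (conolly-even k i (≤-trans (n≤1+n i) i≤r))) (⌈k*2/2⌉ (suc k))))))

-- The C-recurrence: its two terms are ⌈C(n)/2⌉ and ⌈C(n-1)/2⌉.
conolly-recurrence-C : ∀ n → 3 ≤ n → conolly n ≡ conolly (n ∸ conolly (n ∸ 1)) + conolly (n ∸ 1 ∸ conolly (n ∸ 2))
conolly-recurrence-C n 3≤n with m≤n⇒∃[o]m+o≡n 3≤n
... | y , refl = trans (conolly-halves (suc (suc y)))
                       (sym (cong₂ _+_ (conolly-nested-⌈/2⌉ (suc (suc y))) (conolly-nested-⌈/2⌉ (suc y))))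

-- The halving rule of the H-recurrence:
-- h (4t) = 2t, h (4t+1) = 2t+1, h (4t+2) = 2t+2, h (4t+3) = 2t+2,
-- i.e. h (2k+1) = k+1 and h (2k) = 2⌈k/2⌉.
h : ℕ → ℕ
h 0 = 0
h 1 = 1
h 2 = 2
h 3 = 2
h (suc (suc (suc (suc c)))) = suc (suc (h c))

h-odd : ∀ k → h (suc (k * 2)) ≡ suc k
h-odd zero          = refl
h-odd (suc zero)    = refl
h-odd (suc (suc k)) = cong (λ m → suc (suc m)) (h-odd k)

h-double-odd : ∀ b → h (suc (b * 2) * 2) ≡ suc (suc (b * 2))
h-double-odd zero    = refl
h-double-odd (suc b) = cong (λ m → suc (suc m)) (h-double-odd b)

h-double-even : ∀ b → h (suc (suc (b * 2)) * 2) ≡ suc (suc (b * 2))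
h-double-even zero    = refl
h-double-even (suc b) = cong (λ m → suc (suc m)) (h-double-even b)

-- h (2k) + h (2k+2) = 2k+2, since ⌈k/2⌉ + ⌈(k+1)/2⌉ = k+1.
h-consecutive : ∀ k → h (k * 2) + h (suc k * 2) ≡ suc k * 2
h-consecutive zero          = refl
h-consecutive (suc zero)    = refl
h-consecutive (suc (suc k)) = begin
    suc (suc (h (k * 2))) + suc (suc (h (suc k * 2)))
  ≡⟨ cong (λ m → suc (suc m)) (+-suc (h (k * 2)) (suc (h (suc k * 2)))) ⟩
    suc (suc (suc (h (k * 2) + suc (h (suc k * 2)))))
  ≡⟨ cong (λ m → suc (suc (suc m))) (+-suc (h (k * 2)) (h (suc k * 2))) ⟩
    suc (suc (suc (suc (h (k * 2) + h (suc k * 2)))))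
  ≡⟨ cong (λ m → suc (suc (suc (suc m)))) (h-consecutive k) ⟩
    suc (suc (suc k)) * 2 ∎

data Parity : ℕ → Set where
  even : ∀ b → Parity (b * 2)
  odd  : ∀ b → Parity (suc (b * 2))

parity : ∀ k → Parity k
parity zero = even 0
parity (suc k) with parity k
... | even b = odd b
... | odd b  = even (suc b)

-- A block of 2k+2 with at least three positions (r_{k+1} ≥ 2) forces k odd,
-- and then h (2k+2) = k+1.
h-long-even-block : ∀ k → 2 ≤ ruler (suc k) → h (suc k * 2) ≡ suc k
h-long-even-block k 2≤r with parity k
... | even b with s≤s () ← subst (2 ≤_) (ruler-odd b) 2≤r
... | odd b  = h-double-even b

conolly-Q+2 : ∀ m → conolly (suc (suc (Q m))) ≡ h (suc m * 2)
conolly-Q+2 m with parity m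
... | even b = begin
    conolly (suc (suc (Q (b * 2))))
  ≡⟨ cong (λ q → conolly (suc q)) (sym (Q-after-odd b)) ⟩
    conolly (suc (Q (suc (b * 2))))
  ≡⟨ conolly-block (suc (b * 2)) 0 (s≤s z≤n) ⟩
    suc (suc (b * 2))
  ≡⟨ sym (h-double-odd b) ⟩
    h (suc (b * 2) * 2) ∎
... | odd b = begin
    conolly (suc (suc (Q (suc (b * 2)))))
  ≡⟨ conolly-block (suc (b * 2)) 1 (subst (1 <_) (sym (ruler-double b)) (s≤s (s≤s z≤n))) ⟩
    suc (suc (b * 2))
  ≡⟨ sym (h-long-even-block (suc (b * 2)) (subst (2 ≤_) (sym (ruler-double b)) (s≤s (s≤s z≤n)))) ⟩
    h (suc (suc (b * 2)) * 2) ∎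

-- The positions Q (2k) + 1 .. Q (2k) + r_{k+1} (the odd value 2k+1 and, when
-- r_{k+1} ≥ 2, the beginning of the block of 2k+2) all have h-value k+1.
h-early : ∀ k i → i < ruler (suc k) → h (conolly (suc (i + Q (k * 2)))) ≡ suc k
h-early k zero    _      = trans (cong h (conolly-odd k)) (h-odd k)
h-early k (suc i) 2+i≤r  = trans (cong h (conolly-even k i (≤-trans (n≤1+n i) (≤-trans (n≤1+n (suc i)) 2+i≤r))))
                                 (h-long-even-block k (≤-trans (s≤s (s≤s z≤n)) 2+i≤r))

conolly-nested-h : ∀ x → conolly (2 + x ∸ conolly x) ≡ h (conolly (2 + x))
conolly-nested-h zero = refl
conolly-nested-h (suc x) with position x
... | odd-block k = begin
    conolly (suc (suc (suc (Q (k * 2)))) ∸ conolly (suc (Q (k * 2))))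
  ≡⟨ cong (λ c → conolly (suc (suc (suc (Q (k * 2)))) ∸ c)) (conolly-odd k) ⟩
    conolly (2 + Q (k * 2) ∸ k * 2)
  ≡⟨ cong conolly (Q-halving k 2) ⟩
    conolly (suc (suc (Q k)))
  ≡⟨ conolly-Q+2 k ⟩
    h (suc k * 2)
  ≡⟨ cong h (sym (conolly-even k 1 (s≤s z≤n))) ⟩
    h (conolly (suc (suc (suc (Q (k * 2)))))) ∎
... | even-block k i i≤r = begin
    conolly (suc (suc (suc (suc (i + Q (k * 2))))) ∸ conolly (suc (suc (i + Q (k * 2)))))
  ≡⟨ cong (λ c → conolly (suc (suc (suc (suc (i + Q (k * 2))))) ∸ c)) (conolly-even k i i≤r) ⟩
    conolly (suc (suc i) + Q (k * 2) ∸ k * 2)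
  ≡⟨ cong conolly (Q-halving k (suc (suc i))) ⟩
    conolly (suc (suc (i + Q k)))
  ≡⟨ two-ahead i≤r ⟩
    h (conolly (suc (suc (suc (suc (i + Q (k * 2))))))) ∎
  where
    two-ahead : ∀ {i} → i ≤ ruler (suc k) →
                conolly (suc (suc (i + Q k))) ≡ h (conolly (suc (suc (suc (suc (i + Q (k * 2)))))))
    two-ahead {i} i≤r with m≤n⇒m<n∨m≡n i≤r
    ... | inj₂ refl = trans (conolly-Q+2 (suc k)) (sym (cong h (conolly-next-even k)))
    ... | inj₁ 1+i≤r with m≤n⇒m<n∨m≡n 1+i≤r
    ...   | inj₁ 2+i≤r = trans (conolly-block k (suc i) 2+i≤r)
                               (sym (trans (cong h (conolly-even k (suc (suc i)) 2+i≤r))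
                                           (h-long-even-block k (≤-trans (s≤s (s≤s z≤n)) 2+i≤r))))
    ...   | inj₂ refl  = trans (conolly-block (suc k) 0 (s≤s z≤n))
                               (sym (trans (cong h (conolly-next-odd k)) (h-odd (suc k))))

window-by : ∀ n {c a b} → conolly n ≡ c → h c ≡ a → h (conolly (n ∸ 3)) ≡ b → c ≡ a + b →
            conolly n ≡ h (conolly n) + h (conolly (n ∸ 3))
window-by n Cn≡c hc≡a hb c≡a+b = trans Cn≡c (trans c≡a+b (sym (cong₂ _+_ (trans (cong h Cn≡c) hc≡a) hb)))

conolly-window : ∀ n → conolly n ≡ h (conolly n) + h (conolly (n ∸ 3))
conolly-window zero = refl
conolly-window (suc x) with position x
... | odd-block zero    = refl
... | odd-block (suc k) =
  window-by (suc (Q (suc k * 2))) (conolly-odd (suc k)) (h-odd (suc k))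
    (subst (λ q → h (conolly (suc q ∸ 3)) ≡ suc k) (sym (Q-even-end k)) (h-early k (v2 (suc k)) ≤-refl))
    (cong suc (k*2≡k+k (suc k)))
... | even-block zero zero _ = refl
... | even-block (suc k) zero _ =
  window-by (suc (suc (Q (suc k * 2)))) (conolly-even (suc k) 0 z≤n) refl
    (subst (λ q → h (conolly (suc (suc q) ∸ 3)) ≡ h (suc k * 2)) (sym (Q-even-end k))
           (cong h (conolly-even k (v2 (suc k)) (n≤1+n _))))
    (sym (trans (+-comm (h (suc (suc k) * 2)) (h (suc k * 2))) (h-consecutive (suc k))))
... | even-block k (suc zero) _ =
  window-by (3 + Q (k * 2)) (conolly-even k 1 (s≤s z≤n)) refl (cong h (conolly-Q (k * 2)))
    (sym (trans (+-comm (h (suc k * 2)) (h (k * 2))) (h-consecutive k)))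
... | even-block k (suc (suc zero)) 2≤r =
  window-by (4 + Q (k * 2)) (conolly-even k 2 2≤r) (h-long-even-block k 2≤r) (h-early k 0 (s≤s z≤n)) (k*2≡k+k (suc k))
... | even-block k (suc (suc (suc i))) 3+i≤r =
  window-by (5 + (i + Q (k * 2))) (conolly-even k (3 + i) 3+i≤r) (h-long-even-block k (≤-trans (s≤s (s≤s z≤n)) 3+i≤r))
    (h-early k (suc i) (≤-trans (n≤1+n (suc (suc i))) 3+i≤r)) (k*2≡k+k (suc k))

-- The H-recurrence: its two terms are h (C(n)) and h (C(n-3)).
conolly-recurrence-H : ∀ n → 6 ≤ n → conolly n ≡ conolly (n ∸ conolly (n ∸ 2)) + conolly (n ∸ 3 ∸ conolly (n ∸ 5))
conolly-recurrence-H n 6≤n with m≤n⇒∃[o]m+o≡n 6≤n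
... | y , refl = trans (conolly-window (6 + y))
                       (sym (cong₂ _+_ (conolly-nested-h (4 + y)) (conolly-nested-h (1 + y))))

InRange : ℕ → ℕ → Set
InRange n x = 1 ≤ x × x < n

Bounded : (ℕ → ℕ) → Set
Bounded f = ∀ m → 1 ≤ m → 1 ≤ f m × f m ≤ m

nested-argument-in-range : ∀ {f} n p q → p < q → q < n → Bounded f → InRange n (n ∸ p ∸ f (n ∸ q))
nested-argument-in-range {f} n p q p<q q<n bounded =
  m<n⇒0<n∸m inner<n-p , ≤-trans (∸-monoʳ-< 1≤inner inner≤n-p) (m∸n≤m n p)
  where
    bounds : 1 ≤ f (n ∸ q) × f (n ∸ q) ≤ n ∸ q
    bounds = bounded (n ∸ q) (m<n⇒0<n∸m q<n)
    1≤inner : 0 < f (n ∸ q)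
    1≤inner = proj₁ bounds
    inner<n-p : f (n ∸ q) < n ∸ p
    inner<n-p = ≤-<-trans (proj₂ bounds) (∸-monoʳ-< p<q (<⇒≤ q<n))
    inner≤n-p : f (n ∸ q) ≤ n ∸ p
    inner≤n-p = <⇒≤ inner<n-p

module NestedRecurrence (a b c d n₀ : ℕ) where

  Recurrence : (ℕ → ℕ) → Set
  Recurrence f = ∀ n → n₀ ≤ n → f n ≡ f (n ∸ a ∸ f (n ∸ b)) + f (n ∸ c ∸ f (n ∸ d))

  ArgumentsInRange : (ℕ → ℕ) → Set
  ArgumentsInRange f = ∀ n → n₀ ≤ n → InRange n (n ∸ a ∸ f (n ∸ b)) × InRange n (n ∸ c ∸ f (n ∸ d))

  arguments-in-range : a < b → b < n₀ → c < d → d < n₀ → ∀ {f} → Bounded f → ArgumentsInRange f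
  arguments-in-range a<b b<n₀ c<d d<n₀ bounded n n₀≤n =
    nested-argument-in-range n a b a<b (<-≤-trans b<n₀ n₀≤n) bounded ,
    nested-argument-in-range n c d c<d (<-≤-trans d<n₀ n₀≤n) bounded

  solution-unique : 0 < b → b < n₀ → 0 < d → d < n₀ →
                    ∀ {f g} → Recurrence f → ArgumentsInRange f → Recurrence g →
                    (∀ n → 1 ≤ n → n < n₀ → g n ≡ f n) → ∀ n → 1 ≤ n → g n ≡ f n
  solution-unique 0<b b<n₀ 0<d d<n₀ {f} {g} f-rec f-args g-rec initial = <-rec P step
    where
      P : ℕ → Set
      P n = 1 ≤ n → g n ≡ f n
      step : ∀ n → (∀ {m} → m < n → P m) → P n
      step n ih 1≤n with n₀ ≤? n
      ... | no n₀≰n  = initial n 1≤n (≰⇒> n₀≰n)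
      ... | yes n₀≤n = begin
          g n
        ≡⟨ g-rec n n₀≤n ⟩
          g (n ∸ a ∸ g (n ∸ b)) + g (n ∸ c ∸ g (n ∸ d))
        ≡⟨ cong₂ _+_ (same-term a b 0<b b<n₀ (proj₁ (f-args n n₀≤n)))
                     (same-term c d 0<d d<n₀ (proj₂ (f-args n n₀≤n))) ⟩
          f (n ∸ a ∸ f (n ∸ b)) + f (n ∸ c ∸ f (n ∸ d))
        ≡⟨ sym (f-rec n n₀≤n) ⟩
          f n ∎
        where
          -- both the inner and the outer argument are earlier positions
          same-term : ∀ p q → 0 < q → q < n₀ → InRange n (n ∸ p ∸ f (n ∸ q)) →
                      g (n ∸ p ∸ g (n ∸ q)) ≡ f (n ∸ p ∸ f (n ∸ q))
          same-term p q 0<q q<n₀ (1≤x , x<n) =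
            trans (cong (λ v → g (n ∸ p ∸ v)) (ih (∸-monoʳ-< 0<q (<⇒≤ q<n)) (m<n⇒0<n∸m q<n)))
                  (ih x<n 1≤x)
            where q<n : q < n
                  q<n = <-≤-trans q<n₀ n₀≤n

module RecurrenceC = NestedRecurrence 0 1 1 2 3
module RecurrenceH = NestedRecurrence 0 2 3 5 6

initial-C : (g : ℕ → ℕ) → g 1 ≡ 1 → g 2 ≡ 2 → ∀ n → 1 ≤ n → n < 3 → g n ≡ conolly n
initial-C g g1 g2 1 _ _ = g1
initial-C g g1 g2 2 _ _ = g2
initial-C g g1 g2 (suc (suc (suc n))) _ (s≤s (s≤s (s≤s ())))

initial-H : (g : ℕ → ℕ) → g 1 ≡ 1 → g 2 ≡ 2 → g 3 ≡ 2 → g 4 ≡ 3 → g 5 ≡ 4 →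
            ∀ n → 1 ≤ n → n < 6 → g n ≡ conolly n
initial-H g g1 g2 g3 g4 g5 1 _ _ = g1
initial-H g g1 g2 g3 g4 g5 2 _ _ = g2
initial-H g g1 g2 g3 g4 g5 3 _ _ = g3
initial-H g g1 g2 g3 g4 g5 4 _ _ = g4
initial-H g g1 g2 g3 g4 g5 5 _ _ = g5
initial-H g g1 g2 g3 g4 g5 (suc (suc (suc (suc (suc (suc n)))))) _ (s≤s (s≤s (s≤s (s≤s (s≤s (s≤s ()))))))

theorem3p1 : IsWellDefinedSolutionC conolly × IsWellDefinedSolutionH conolly
theorem3p1 = (solvesC , argumentsC , uniqueC) , (solvesH , argumentsH , uniqueH)
  where
    solvesC : SolvesC conolly
    solvesC = refl , refl , conolly-recurrence-C

    argumentsC : WellDefinedC conolly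
    argumentsC = RecurrenceC.arguments-in-range z<s (s<s z<s) (s<s z<s) (s<s (s<s z<s)) conolly-bounds

    uniqueC : (g : ℕ → ℕ) → SolvesC g → ∀ n → 1 ≤ n → g n ≡ conolly n
    uniqueC g (g1 , g2 , g-rec) = RecurrenceC.solution-unique z<s (s<s z<s) z<s (s<s (s<s z<s))
      conolly-recurrence-C argumentsC g-rec (initial-C g g1 g2)

    solvesH : SolvesH conolly
    solvesH = refl , refl , refl , refl , refl , conolly-recurrence-H

    argumentsH : WellDefinedH conolly
    argumentsH = RecurrenceH.arguments-in-range z<s (s<s (s<s z<s)) (s<s (s<s (s<s z<s))) (n<1+n 5) conolly-bounds

    uniqueH : (g : ℕ → ℕ) → SolvesH g → ∀ n → 1 ≤ n → g n ≡ conolly n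
    uniqueH g (g1 , g2 , g3 , g4 , g5 , g-rec) = RecurrenceH.solution-unique z<s (s<s (s<s z<s)) z<s (n<1+n 5)
      conolly-recurrence-H argumentsH g-rec (initial-H g g1 g2 g3 g4 g5)
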